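{- Let $\mathcal{H}$ be a directed hypergraph and let $l$ be an intersecting supermodular weakly subadditive integer-valued function on subsets of $V(\mathcal{H})$. If $\mathcal{H}$ is $l$-sparse, then it can be trimmed to an $l$-sparse directed graph.
   Context: Hypergraphs are finite, may have repeated hyperedges, and every hyperedge has size at least two. A directed hypergraph is a hypergraph in which each hyperedge $Z$ has a specified head vertex $u\in Z$. Trimming a directed hyperedge $Z$ of size at least three with head $u$ means replacing $Z$ by a subset of $Z$ containing $u$ of size at least two (with the same head); a trimmed hypergraph is one obtained by a sequence of such operations; a directed graph here is a directed hypergraph all of whose hyperedges have size two. $l(\emptyset)=0$, $l(v)=l(\{v\})$. $l$ is intersecting supermodular if $l(A\cap B)+l(A\cup B)\ge l(A)+l(B)$ whenever $A\cap B\neq\emptyset$; weakly subadditive if $\sum_{v\in A}l(v)\ge l(A)$ for all $A$. A hypergraph $\mathcal{F}$ is $l$-sparse if $e_{\mathcal{F}}(A)\le\sum_{v\in A}l(v)-l(A)$ for all vertex sets $A$, where $e_{\mathcal{F}}(A)$ is the number of hyperedges $Z$ with $Z\subseteq A$. -}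

module Defs where

open import Data.Nat using (ℕ; _≤_)
open import Data.Integer using (ℤ; _+_; _-_; _≤_; +_; 0ℤ)
open import Data.Fin using (Fin; zero; suc)
open import Data.Fin.Subset using (Subset; _∈_; _⊆_; _∩_; _∪_; ⁅_⁆; ∣_∣; Nonempty; ⊥)
open import Data.Fin.Subset.Properties using (_⊆?_)
open import Data.Bool using (true; false)
open import Data.Vec using (_∷_; [])
open import Data.List using (List; _∷_; []; length; filter)
open import Data.List.Relation.Unary.All using (All)
open import Relation.Binary.PropositionalEquality using (_≡_)
open import Relation.Binary.Construct.Closure.ReflexiveTransitive using (Star)

record DHyperedge (n : ℕ) : Set where
  constructor dedge
  field
    verts   : Subset n
    head    : Fin n
    head∈   : head ∈ verts
    size≥2  : 2 Data.Nat.≤ ∣ verts ∣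
open DHyperedge public

DHypergraph : ℕ → Set
DHypergraph n = List (DHyperedge n)

record TrimEdge {n : ℕ} (e e' : DHyperedge n) : Set where
  field
    big     : 3 Data.Nat.≤ ∣ verts e ∣
    sub     : verts e' ⊆ verts e
    sameHd  : head e' ≡ head e

data TrimStep {n : ℕ} : DHypergraph n → DHypergraph n → Set where
  here  : ∀ {e e' H} → TrimEdge e e' → TrimStep (e ∷ H) (e' ∷ H)
  there : ∀ {e H H'} → TrimStep H H' → TrimStep (e ∷ H) (e ∷ H')

TrimmedTo : ∀ {n} → DHypergraph n → DHypergraph n → Set
TrimmedTo = Star TrimStep

IsDirectedGraph : ∀ {n} → DHypergraph n → Set
IsDirectedGraph = All (λ e → ∣ verts e ∣ ≡ 2)

eCount : ∀ {n} → DHypergraph n → Subset n → ℕ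
eCount F A = length (filter (λ e → verts e ⊆? A) F)

sumOver : ∀ {n} → Subset n → (Fin n → ℤ) → ℤ
sumOver []            f = 0ℤ
sumOver (true  ∷ A)   f = f zero + sumOver A (λ i → f (suc i))
sumOver (false ∷ A)   f = sumOver A (λ i → f (suc i))

IntersectingSupermodular : ∀ {n} → (Subset n → ℤ) → Set
IntersectingSupermodular {n} l =
  ∀ (A B : Subset n) → Nonempty (A ∩ B) → l A + l B Data.Integer.≤ l (A ∩ B) + l (A ∪ B)

WeaklySubadditive : ∀ {n} → (Subset n → ℤ) → Set
WeaklySubadditive {n} l = ∀ (A : Subset n) → l A Data.Integer.≤ sumOver A (λ v → l ⁅ v ⁆)

Sparse : ∀ {n} → (Subset n → ℤ) → DHypergraph n → Set
Sparse {n} l F = ∀ (A : Subset n) → + eCount F A Data.Integer.≤ sumOver A (λ v → l ⁅ v ⁆) - l A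

-- Write f(A) = Σ_{v ∈ A} l(v) − l(A), so that sparsity says e(A) ≤ f(A); f is intersecting
-- submodular, while edge counts are supermodular.  Hyperedges are trimmed one vertex at a
-- time, keeping all other hyperedges fixed.  If a hyperedge Z with head u and |Z| ≥ 3 had
-- two vertices w₁ ≠ w₂ in Z − u neither of which could be removed, there would be sets
-- A₁ ⊇ Z − w₁ and A₂ ⊇ Z − w₂ that are tight for the other hyperedges.  They meet in u, so
-- uncrossing makes A₁ ∪ A₂ tight for them too; but A₁ ∪ A₂ ⊇ Z, so Z itself would not fit.

module Submission where

open import Defs
open import Data.Nat using (ℕ)
open import Data.Integer using (ℤ; 0ℤ)
open import Data.Fin.Subset using (Subset; ⊥)
open import Data.Product using (Σ-syntax; _×_)
open import Relation.Binary.PropositionalEquality using (_≡_)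

import Algebra.Properties.CommutativeSemigroup as CommutativeSemigroupProperties
open import Data.Bool using (true; false)
open import Data.Empty using (⊥-elim)
open import Data.Fin using (Fin; zero; suc; _≟_)
open import Data.Fin.Subset using (_∈_; _⊆_; _∩_; _∪_; _-_; ⁅_⁆; ∣_∣; Nonempty; inside; outside)
open import Data.Fin.Subset.Properties
  using (_⊆?_; anySubset?; x∈p∩q⁺; p⊆p∪q; q⊆p∪q; p─q⊆p; p─⊥≡p; x∈p∧x≢y⇒x∈p-y)
open import Data.Integer as ℤ using (+_; -_)
import Data.Integer.Properties as ℤ
open import Data.List using (_∷_; []; _++_; [_])
open import Data.List.Properties using (++-assoc)
open import Data.List.Relation.Unary.All using (_∷_; [])
open import Data.Nat as ℕ using (zero; suc; z≤n)
import Data.Nat.Properties as ℕ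
open import Data.Product using (_,_; ∃₂; ∃-syntax)
open import Data.Sum using (_⊎_; inj₁; inj₂)
open import Data.Vec using (_∷_; []; here; there)
open import Function using (_∘_)
open import Relation.Nullary using (Dec; yes; no; ¬_)
open import Relation.Binary.PropositionalEquality
  using (_≢_; _≗_; refl; sym; trans; cong; subst; module ≡-Reasoning)
open import Relation.Binary.Construct.Closure.ReflexiveTransitive using (Star; ε; _◅_; _◅◅_; gmap)

private
  variable
    n : ℕ
    x y : Fin n
    p : Subset n

  module ℕ+ = CommutativeSemigroupProperties ℕ.+-commutativeSemigroup
  module ℤ+ = CommutativeSemigroupProperties ℤ.+-commutativeSemigroup

x∈p-y⇒x≢y : x ∈ p - y → x ≢ y
x∈p-y⇒x≢y {x = zero}  {p = _ ∷ p} {y = zero}  () refl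
x∈p-y⇒x≢y {x = suc x} {p = _ ∷ p} {y = suc x} (there x∈p-x) refl = x∈p-y⇒x≢y x∈p-x refl

x∈p-y⇒x∈p : x ∈ p - y → x ∈ p
x∈p-y⇒x∈p {p = p} {y = y} = p─q⊆p p ⁅ y ⁆

x∈p⇒suc∣p-x∣≡∣p∣ : x ∈ p → suc ∣ p - x ∣ ≡ ∣ p ∣
x∈p⇒suc∣p-x∣≡∣p∣ {x = zero}  {p = inside ∷ p}  here        = cong suc (cong ∣_∣ (p─⊥≡p p))
x∈p⇒suc∣p-x∣≡∣p∣ {x = suc x} {p = inside ∷ p}  (there x∈p) = cong suc (x∈p⇒suc∣p-x∣≡∣p∣ x∈p)
x∈p⇒suc∣p-x∣≡∣p∣ {x = suc x} {p = outside ∷ p} (there x∈p) = x∈p⇒suc∣p-x∣≡∣p∣ x∈p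

0<∣p∣⇒Nonempty : 0 ℕ.< ∣ p ∣ → Nonempty p
0<∣p∣⇒Nonempty {p = inside ∷ p}  _      = zero , here
0<∣p∣⇒Nonempty {p = outside ∷ p} 0<∣p∣ with 0<∣p∣⇒Nonempty 0<∣p∣
... | x , x∈p = suc x , there x∈p

x∈p∧k<∣p∣⇒k≤∣p-x∣ : ∀ {k} → x ∈ p → k ℕ.< ∣ p ∣ → k ℕ.≤ ∣ p - x ∣
x∈p∧k<∣p∣⇒k≤∣p-x∣ {k = k} x∈p k<∣p∣ = ℕ.≤-pred (subst (suc k ℕ.≤_) (sym (x∈p⇒suc∣p-x∣≡∣p∣ x∈p)) k<∣p∣)

two-other-elements : x ∈ p → 3 ℕ.≤ ∣ p ∣ →
                     ∃₂ λ y z → y ∈ p × z ∈ p × x ≢ y × x ≢ z × y ≢ z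
two-other-elements {x = x} {p = p} x∈p 2<∣p∣ =
  let 1<∣p-x∣     = x∈p∧k<∣p∣⇒k≤∣p-x∣ x∈p 2<∣p∣
      y , y∈p-x   = 0<∣p∣⇒Nonempty (ℕ.<⇒≤ 1<∣p-x∣)
      z , z∈p-x-y = 0<∣p∣⇒Nonempty (x∈p∧k<∣p∣⇒k≤∣p-x∣ {p = p - x} y∈p-x 1<∣p-x∣)
      z∈p-x       = x∈p-y⇒x∈p {p = p - x} z∈p-x-y
  in y , z , x∈p-y⇒x∈p {p = p} y∈p-x , x∈p-y⇒x∈p {p = p} z∈p-x ,
     x∈p-y⇒x≢y {p = p} y∈p-x ∘ sym , x∈p-y⇒x≢y {p = p} z∈p-x ∘ sym ,
     x∈p-y⇒x≢y {p = p - x} z∈p-x-y ∘ sym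

Supermodular : (Subset n → ℕ) → Set
Supermodular R = ∀ A B → R A ℕ.+ R B ℕ.≤ R (A ∩ B) ℕ.+ R (A ∪ B)

indicator : ∀ {a} {P : Set a} → Dec P → ℕ
indicator (yes _) = 1
indicator (no _)  = 0

covers : Subset n → Subset n → ℕ
covers Z A = indicator (Z ⊆? A)

covers-⊆ : ∀ {Z A : Subset n} → Z ⊆ A → covers Z A ≡ 1
covers-⊆ {Z = Z} {A} Z⊆A with Z ⊆? A
... | yes _   = refl
... | no Z⊈A = ⊥-elim (Z⊈A Z⊆A)

1≤covers : ∀ {Z A : Subset n} → Z ⊆ A → 1 ℕ.≤ covers Z A
1≤covers Z⊆A = ℕ.≤-reflexive (sym (covers-⊆ Z⊆A))

covers-supermodular : (Z : Subset n) → Supermodular (covers Z)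
covers-supermodular Z A B with Z ⊆? A | Z ⊆? B
... | yes Z⊆A | yes Z⊆B =
  ℕ.+-mono-≤ (1≤covers λ x∈Z → x∈p∩q⁺ (Z⊆A x∈Z , Z⊆B x∈Z)) (1≤covers (p⊆p∪q B ∘ Z⊆A))
... | yes Z⊆A | no _    = ℕ.≤-trans (1≤covers (p⊆p∪q B ∘ Z⊆A)) (ℕ.m≤n+m _ _)
... | no _    | yes Z⊆B = ℕ.≤-trans (1≤covers (q⊆p∪q A B ∘ Z⊆B)) (ℕ.m≤n+m _ _)
... | no _    | no _    = z≤n

+-supermodular : {R Q : Subset n → ℕ} → Supermodular R → Supermodular Q →
                 Supermodular (λ A → R A ℕ.+ Q A)
+-supermodular {R = R} {Q} R-super Q-super A B = begin
  (R A ℕ.+ Q A) ℕ.+ (R B ℕ.+ Q B)                          ≡⟨ ℕ+.interchange (R A) (Q A) (R B) (Q B) ⟩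
  (R A ℕ.+ R B) ℕ.+ (Q A ℕ.+ Q B)                          ≤⟨ ℕ.+-mono-≤ (R-super A B) (Q-super A B) ⟩
  (R (A ∩ B) ℕ.+ R (A ∪ B)) ℕ.+ (Q (A ∩ B) ℕ.+ Q (A ∪ B)) ≡⟨ ℕ+.interchange (R (A ∩ B)) (R (A ∪ B)) (Q (A ∩ B)) (Q (A ∪ B)) ⟩
  (R (A ∩ B) ℕ.+ Q (A ∩ B)) ℕ.+ (R (A ∪ B) ℕ.+ Q (A ∪ B)) ∎
  where open ℕ.≤-Reasoning

eCount-∷ : ∀ (e : DHyperedge n) F A → eCount (e ∷ F) A ≡ covers (verts e) A ℕ.+ eCount F A
eCount-∷ e F A with verts e ⊆? A
... | yes _ = refl
... | no _  = refl

eCount-insert : ∀ D (e : DHyperedge n) F A →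
                eCount (D ++ e ∷ F) A ≡ covers (verts e) A ℕ.+ eCount (D ++ F) A
eCount-insert []      e F A = eCount-∷ e F A
eCount-insert (d ∷ D) e F A = begin
  eCount (d ∷ D ++ e ∷ F) A                                       ≡⟨ eCount-∷ d _ A ⟩
  covers (verts d) A ℕ.+ eCount (D ++ e ∷ F) A                    ≡⟨ cong (covers (verts d) A ℕ.+_) (eCount-insert D e F A) ⟩
  covers (verts d) A ℕ.+ (covers (verts e) A ℕ.+ eCount (D ++ F) A) ≡⟨ ℕ+.x∙yz≈y∙xz (covers (verts d) A) (covers (verts e) A) _ ⟩
  covers (verts e) A ℕ.+ (covers (verts d) A ℕ.+ eCount (D ++ F) A) ≡⟨ cong (covers (verts e) A ℕ.+_) (eCount-∷ d _ A) ⟨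
  covers (verts e) A ℕ.+ eCount (d ∷ D ++ F) A                    ∎
  where open ≡-Reasoning

eCount-supermodular : (F : DHypergraph n) → Supermodular (eCount F)
eCount-supermodular []      A B = z≤n
eCount-supermodular (e ∷ F) A B
  rewrite eCount-∷ e F A | eCount-∷ e F B | eCount-∷ e F (A ∩ B) | eCount-∷ e F (A ∪ B)
  = +-supermodular {R = covers (verts e)} {Q = eCount F} (covers-supermodular (verts e)) (eCount-supermodular F) A B

private
  module SplitHead (g : Fin (suc n) → ℤ) where
    g₀ : ℤ
    g₀ = g zero
    s : Subset n → ℤ
    s C = sumOver C (g ∘ suc)

sumOver-modular : ∀ (A B : Subset n) g →
  sumOver (A ∩ B) g ℤ.+ sumOver (A ∪ B) g ≡ sumOver A g ℤ.+ sumOver B g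
sumOver-modular []          []          g = refl
sumOver-modular (true ∷ A)  (true ∷ B)  g = begin
  (g₀ ℤ.+ s (A ∩ B)) ℤ.+ (g₀ ℤ.+ s (A ∪ B)) ≡⟨ ℤ+.interchange g₀ (s (A ∩ B)) g₀ (s (A ∪ B)) ⟩
  (g₀ ℤ.+ g₀) ℤ.+ (s (A ∩ B) ℤ.+ s (A ∪ B)) ≡⟨ cong (ℤ._+_ (g₀ ℤ.+ g₀)) (sumOver-modular A B (g ∘ suc)) ⟩
  (g₀ ℤ.+ g₀) ℤ.+ (s A ℤ.+ s B)             ≡⟨ ℤ+.interchange g₀ g₀ (s A) (s B) ⟩
  (g₀ ℤ.+ s A) ℤ.+ (g₀ ℤ.+ s B)             ∎
  where open ≡-Reasoning; open SplitHead g
sumOver-modular (true ∷ A)  (false ∷ B) g = begin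
  s (A ∩ B) ℤ.+ (g₀ ℤ.+ s (A ∪ B))          ≡⟨ ℤ+.x∙yz≈y∙xz (s (A ∩ B)) g₀ (s (A ∪ B)) ⟩
  g₀ ℤ.+ (s (A ∩ B) ℤ.+ s (A ∪ B))          ≡⟨ cong (ℤ._+_ g₀) (sumOver-modular A B (g ∘ suc)) ⟩
  g₀ ℤ.+ (s A ℤ.+ s B)                      ≡⟨ ℤ.+-assoc g₀ (s A) (s B) ⟨
  (g₀ ℤ.+ s A) ℤ.+ s B                      ∎
  where open ≡-Reasoning; open SplitHead g
sumOver-modular (false ∷ A) (true ∷ B)  g = begin
  s (A ∩ B) ℤ.+ (g₀ ℤ.+ s (A ∪ B))          ≡⟨ ℤ+.x∙yz≈y∙xz (s (A ∩ B)) g₀ (s (A ∪ B)) ⟩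
  g₀ ℤ.+ (s (A ∩ B) ℤ.+ s (A ∪ B))          ≡⟨ cong (ℤ._+_ g₀) (sumOver-modular A B (g ∘ suc)) ⟩
  g₀ ℤ.+ (s A ℤ.+ s B)                      ≡⟨ ℤ+.x∙yz≈y∙xz (s A) g₀ (s B) ⟨
  s A ℤ.+ (g₀ ℤ.+ s B)                      ∎
  where open ≡-Reasoning; open SplitHead g
sumOver-modular (false ∷ A) (false ∷ B) g = sumOver-modular A B (g ∘ suc)

[a-b]+[c-d]≡[a+c]-[b+d] : ∀ a b c d → (a ℤ.- b) ℤ.+ (c ℤ.- d) ≡ (a ℤ.+ c) ℤ.- (b ℤ.+ d)
[a-b]+[c-d]≡[a+c]-[b+d] a b c d = begin
  (a ℤ.+ - b) ℤ.+ (c ℤ.+ - d) ≡⟨ ℤ+.interchange a (- b) c (- d) ⟩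
  (a ℤ.+ c) ℤ.+ (- b ℤ.+ - d) ≡⟨ cong (ℤ._+_ (a ℤ.+ c)) (ℤ.neg-distrib-+ b d) ⟨
  (a ℤ.+ c) ℤ.- (b ℤ.+ d)     ∎
  where open ≡-Reasoning

module Trimming {n : ℕ} (l : Subset n → ℤ) (l-supermodular : IntersectingSupermodular l) where

  slack : Subset n → ℤ
  slack A = sumOver A (λ v → l ⁅ v ⁆) ℤ.- l A

  slack-submodular : ∀ A B → Nonempty (A ∩ B) →
                     slack (A ∩ B) ℤ.+ slack (A ∪ B) ℤ.≤ slack A ℤ.+ slack B
  slack-submodular A B A∩B≢∅ = begin
    slack (A ∩ B) ℤ.+ slack (A ∪ B)                 ≡⟨ [a-b]+[c-d]≡[a+c]-[b+d] (s (A ∩ B)) (l (A ∩ B)) (s (A ∪ B)) (l (A ∪ B)) ⟩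
    (s (A ∩ B) ℤ.+ s (A ∪ B)) ℤ.- (l (A ∩ B) ℤ.+ l (A ∪ B)) ≡⟨ cong (ℤ._- (l (A ∩ B) ℤ.+ l (A ∪ B))) (sumOver-modular A B _) ⟩
    (s A ℤ.+ s B) ℤ.- (l (A ∩ B) ℤ.+ l (A ∪ B))     ≤⟨ ℤ.+-monoʳ-≤ (s A ℤ.+ s B) (ℤ.neg-mono-≤ (l-supermodular A B A∩B≢∅)) ⟩
    (s A ℤ.+ s B) ℤ.- (l A ℤ.+ l B)                 ≡⟨ [a-b]+[c-d]≡[a+c]-[b+d] (s A) (l A) (s B) (l B) ⟨
    slack A ℤ.+ slack B                             ∎
    where
      open ℤ.≤-Reasoning
      s : Subset n → ℤ
      s A = sumOver A (λ v → l ⁅ v ⁆)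

  Fits : (Subset n → ℕ) → Set
  Fits R = ∀ A → + R A ℤ.≤ slack A

  Tight : (Subset n → ℕ) → Subset n → Set
  Tight R A = slack A ℤ.≤ + R A

  fits-≗ : {R Q : Subset n → ℕ} → R ≗ Q → Fits R → Fits Q
  fits-≗ R≗Q fits A = subst (λ k → + k ℤ.≤ slack A) (R≗Q A) (fits A)

  fits-or-violated : (R : Subset n → ℕ) → Fits R ⊎ ∃[ A ] slack A ℤ.< + R A
  fits-or-violated R with anySubset? (λ A → slack A ℤ.<? + R A)
  ... | yes violated = inj₂ violated
  ... | no ¬violated = inj₁ λ A → ℤ.≮⇒≥ λ violation → ¬violated (A , violation)

  violated⇒tight : ∀ {R} {Z Z′ A : Subset n} → Fits (λ B → covers Z B ℕ.+ R B) →
                   slack A ℤ.< + (covers Z′ A ℕ.+ R A) → Z′ ⊆ A × Tight R A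
  violated⇒tight {R} {Z} {Z′} {A} fits violation with Z′ ⊆? A
  ... | yes Z′⊆A = Z′⊆A , ℤ.i<j⇒i≤pred[j] violation
  ... | no _     = ⊥-elim (ℤ.<⇒≱ violation (ℤ.≤-trans (ℤ.+≤+ (ℕ.m≤n+m (R A) _)) (fits A)))

  -- Uncrossing would make A₁ ∪ A₂ tight for R, leaving no room for Z.
  tight-∪-⊉ : ∀ {R} {Z A₁ A₂ : Subset n} → Supermodular R → Fits (λ B → covers Z B ℕ.+ R B) →
              Tight R A₁ → Tight R A₂ → Nonempty (A₁ ∩ A₂) → ¬ Z ⊆ A₁ ∪ A₂
  tight-∪-⊉ {R} {Z} {A₁} {A₂} R-super fits tight₁ tight₂ A₁∩A₂≢∅ Z⊆A₁∪A₂ =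
    ℕ.n≮n (R (A₁ ∪ A₂)) (ℕ.+-cancelˡ-≤ (R (A₁ ∩ A₂)) _ _ (ℤ.drop‿+≤+ (begin
      + (R (A₁ ∩ A₂) ℕ.+ suc (R (A₁ ∪ A₂)))  ≡⟨ ℤ.pos-+ (R (A₁ ∩ A₂)) _ ⟩
      + R (A₁ ∩ A₂) ℤ.+ + suc (R (A₁ ∪ A₂))  ≤⟨ ℤ.+-mono-≤ fits∩ fits∪ ⟩
      slack (A₁ ∩ A₂) ℤ.+ slack (A₁ ∪ A₂)    ≤⟨ slack-submodular A₁ A₂ A₁∩A₂≢∅ ⟩
      slack A₁ ℤ.+ slack A₂                  ≤⟨ ℤ.+-mono-≤ tight₁ tight₂ ⟩
      + R A₁ ℤ.+ + R A₂                      ≡⟨ ℤ.pos-+ (R A₁) (R A₂) ⟨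
      + (R A₁ ℕ.+ R A₂)                      ≤⟨ ℤ.+≤+ (R-super A₁ A₂) ⟩
      + (R (A₁ ∩ A₂) ℕ.+ R (A₁ ∪ A₂))        ∎)))
    where
      open ℤ.≤-Reasoning
      fits∩ : + R (A₁ ∩ A₂) ℤ.≤ slack (A₁ ∩ A₂)
      fits∩ = ℤ.≤-trans (ℤ.+≤+ (ℕ.m≤n+m _ _)) (fits (A₁ ∩ A₂))
      fits∪ : + suc (R (A₁ ∪ A₂)) ℤ.≤ slack (A₁ ∪ A₂)
      fits∪ = subst (λ k → + (k ℕ.+ R (A₁ ∪ A₂)) ℤ.≤ _) (covers-⊆ Z⊆A₁∪A₂) (fits (A₁ ∪ A₂))

  removable-vertex : ∀ {R} {Z : Subset n} {u} → Supermodular R → u ∈ Z → 3 ℕ.≤ ∣ Z ∣ →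
                     Fits (λ A → covers Z A ℕ.+ R A) →
                     ∃[ w ] w ∈ Z × u ≢ w × Fits (λ A → covers (Z - w) A ℕ.+ R A)
  removable-vertex {R} {Z} {u} R-super u∈Z 3≤∣Z∣ fits
    with two-other-elements u∈Z 3≤∣Z∣
  ... | w₁ , w₂ , w₁∈Z , w₂∈Z , u≢w₁ , u≢w₂ , w₁≢w₂
    with fits-or-violated (λ A → covers (Z - w₁) A ℕ.+ R A)
       | fits-or-violated (λ A → covers (Z - w₂) A ℕ.+ R A)
  ... | inj₁ fits₁ | _          = w₁ , w₁∈Z , u≢w₁ , fits₁
  ... | inj₂ _     | inj₁ fits₂ = w₂ , w₂∈Z , u≢w₂ , fits₂
  ... | inj₂ (A₁ , violation₁) | inj₂ (A₂ , violation₂)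
    with violated⇒tight {R} {Z} fits violation₁ | violated⇒tight {R} {Z} fits violation₂
  ... | Z-w₁⊆A₁ , tight₁ | Z-w₂⊆A₂ , tight₂ =
    ⊥-elim (tight-∪-⊉ {R} {Z} R-super fits tight₁ tight₂ u∈A₁∩A₂ Z⊆A₁∪A₂)
    where
      u∈A₁∩A₂ : Nonempty (A₁ ∩ A₂)
      u∈A₁∩A₂ = u , x∈p∩q⁺ (Z-w₁⊆A₁ (x∈p∧x≢y⇒x∈p-y u∈Z u≢w₁) , Z-w₂⊆A₂ (x∈p∧x≢y⇒x∈p-y u∈Z u≢w₂))
      Z⊆A₁∪A₂ : Z ⊆ A₁ ∪ A₂
      Z⊆A₁∪A₂ {x} x∈Z with x ≟ w₁
      ... | yes refl = q⊆p∪q A₁ A₂ (Z-w₂⊆A₂ (x∈p∧x≢y⇒x∈p-y x∈Z w₁≢w₂))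
      ... | no x≢w₁  = p⊆p∪q A₂ (Z-w₁⊆A₁ (x∈p∧x≢y⇒x∈p-y x∈Z x≢w₁))

  trim-to-arc : ∀ {R} → Supermodular R → ∀ k (e : DHyperedge n) → ∣ verts e ∣ ≡ 2 ℕ.+ k →
                Fits (λ A → covers (verts e) A ℕ.+ R A) →
                Σ[ e′ ∈ DHyperedge n ] Star TrimEdge e e′ × ∣ verts e′ ∣ ≡ 2 ×
                                       Fits (λ A → covers (verts e′) A ℕ.+ R A)
  trim-to-arc {R} R-super zero    e ∣e∣≡2 fits = e , ε , ∣e∣≡2 , fits
  trim-to-arc {R} R-super (suc k) e ∣e∣≡3+k fits =
    let w , w∈e , head≢w , fits′ = removable-vertex {R} {verts e} R-super (head∈ e) 3≤∣e∣ fits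
        ∣e-w∣≡2+k : ∣ verts e - w ∣ ≡ 2 ℕ.+ k
        ∣e-w∣≡2+k = ℕ.suc-injective (trans (x∈p⇒suc∣p-x∣≡∣p∣ w∈e) ∣e∣≡3+k)
        e₁ : DHyperedge n
        e₁ = dedge (verts e - w) (head e) (x∈p∧x≢y⇒x∈p-y (head∈ e) head≢w)
                   (subst (2 ℕ.≤_) (sym ∣e-w∣≡2+k) (ℕ.m≤m+n 2 k))
        e↝e₁ : TrimEdge e e₁
        e↝e₁ = record { big = 3≤∣e∣ ; sub = p─q⊆p (verts e) ⁅ w ⁆ ; sameHd = refl }
        e′ , e₁↝e′ , ∣e′∣≡2 , fits″ = trim-to-arc R-super k e₁ ∣e-w∣≡2+k fits′
    in e′ , e↝e₁ ◅ e₁↝e′ , ∣e′∣≡2 , fits″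
    where
      3≤∣e∣ : 3 ℕ.≤ ∣ verts e ∣
      3≤∣e∣ = subst (3 ℕ.≤_) (sym ∣e∣≡3+k) (ℕ.m≤m+n 3 k)

  trim-hyperedge : ∀ D (e : DHyperedge n) F → Fits (eCount (D ++ e ∷ F)) →
                   Σ[ e′ ∈ DHyperedge n ] Star TrimEdge e e′ × ∣ verts e′ ∣ ≡ 2 ×
                                          Fits (eCount (D ++ e′ ∷ F))
  trim-hyperedge D e F fits =
    let e′ , e↝e′ , ∣e′∣≡2 , fits′ =
          trim-to-arc (eCount-supermodular (D ++ F)) (∣ verts e ∣ ℕ.∸ 2) e
                      (sym (ℕ.m+[n∸m]≡n (size≥2 e))) (fits-≗ (eCount-insert D e F) fits)
    in e′ , e↝e′ , ∣e′∣≡2 , fits-≗ (sym ∘ eCount-insert D e′ F) fits′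

  trim-all : ∀ D (H : DHypergraph n) → Fits (eCount (D ++ H)) →
             Σ[ G ∈ DHypergraph n ] TrimmedTo H G × IsDirectedGraph G × Fits (eCount (D ++ G))
  trim-all D []      fits = [] , ε , [] , fits
  trim-all D (e ∷ H) fits =
    let e′ , e↝e′ , ∣e′∣≡2 , fits′ = trim-hyperedge D e H fits
        G , H↝G , G-graph , fitsG =
          trim-all (D ++ [ e′ ]) H (subst (Fits ∘ eCount) (sym (++-assoc D [ e′ ] H)) fits′)
    in e′ ∷ G , gmap (_∷ H) TrimStep.here e↝e′ ◅◅ gmap (e′ ∷_) TrimStep.there H↝G ,
       ∣e′∣≡2 ∷ G-graph , subst (Fits ∘ eCount) (++-assoc D [ e′ ] G) fitsG

mainTheorem13 : (n : ℕ) (H : DHypergraph n) (l : Subset n → ℤ) →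
    l ⊥ ≡ 0ℤ → IntersectingSupermodular l → WeaklySubadditive l →
    Sparse l H →
    Σ[ G ∈ DHypergraph n ] (TrimmedTo H G × IsDirectedGraph G × Sparse l G)
mainTheorem13 n H l _ l-supermodular _ H-sparse = trim-all [] H H-sparse
  where open Trimming l l-supermodular
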